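{- For every atomic system $S$, every nonempty set $\Gamma$ of ecumenical formulas and every ecumenical formula $A$: if $\Gamma\Vdash^L_S A$ then $\Gamma\Vdash^G_S A$.
   Context: Basic setting. Let $\mathsf{At}$ be a countably infinite set of atomic propositions and $\mathsf{At}_\bot=\mathsf{At}\cup\{\bot\}$. An atomic rule has the form "from premises $p_1,\dots,p_n$ ($n\ge 0$) infer $p$", with $p_j,p\in\mathsf{At}_\bot$, where the derivation of each premise may discharge a set of basic sentences. An atomic system $S$ is a set of atomic rules; $S\subseteq S'$ ($S'$ extends $S$) if $S'$ contains all rules of $S$. $\Delta\vdash_S p$ means there is a natural-deduction derivation using only rules of $S$ with conclusion $p$ and undischarged assumptions in $\Delta$ (so $p\vdash_S p$). $S$ is consistent if $\nvdash_S\bot$. Standing convention: all atomic systems (including all extensions quantified over) are required to be consistent. Ecumenical formulas: $p^i,p^c$ for $p\in\mathsf{At}_\bot$; $(A\wedge B)^x,(A\vee B)^x,(A\to B)^x$ for $x\in\{i,c\}$. $\bot$ denotes $\bot^i$; for $X^c$, $X^i$ is the same construction with outer superscript $i$. Weak validity (by simultaneous recursion): (1) $\Vdash^L_S p^i$ iff $\vdash_S p$ ($p\in\mathsf{At}_\bot$); (2) $\Vdash^L_S p^c$ iff $p\nvdash_S\bot$; (3) for non-atomic $X$, $\Vdash^L_S X^c$ iff $X^i\nVdash^L_S\bot$; (4) $\Vdash^L_S(A\wedge B)^i$ iff $\Vdash^L_S A$ and $\Vdash^L_S B$; (5) $\Vdash^L_S(A\to B)^i$ iff $A\Vdash^G_S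 B$; (6) $\Vdash^L_S(A\vee B)^i$ iff for all $S'\supseteq S$ and all $p\in\mathsf{At}_\bot$, if $A\Vdash^L_{S'}p^i$ and $B\Vdash^L_{S'}p^i$ then $\Vdash^L_{S'}p^i$; (7) for nonempty $\Gamma$, $\Gamma\Vdash^L_S A$ iff for all $S'\supseteq S$, if $\Vdash^L_{S'}B$ for all $B\in\Gamma$ then $\Vdash^L_{S'}A$; (8) $\Gamma\Vdash^G_S A$ iff for all $S'\supseteq S$: if $\Vdash^L_{S''}B$ for all $B\in\Gamma$ and all $S''\supseteq S'$, then $\Vdash^L_{S''}A$ for all $S''\supseteq S'$. -}

module Defs where

open import Level using (Level; Lift; 0ℓ) renaming (suc to lsuc)
open import Data.Nat using (ℕ)
open import Data.Fin using (Fin)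
open import Data.List using (List; []; _∷_; _++_)
open import Data.List.Membership.Propositional using (_∈_)
open import Data.Product using (_×_; Σ)
open import Relation.Nullary using (¬_)

data At⊥ : Set where
  atm : ℕ → At⊥
  bot : At⊥

record Rule : Set where
  field
    arity      : ℕ
    premise    : Fin arity → At⊥
    discharged : Fin arity → List At⊥
    conclusion : At⊥
open Rule public

RuleSet : Set₁
RuleSet = Rule → Set

data Derives (R : RuleSet) : List At⊥ → At⊥ → Set where
  assume : ∀ {Δ p} → p ∈ Δ → Derives R Δ p
  apply  : ∀ {Δ} (r : Rule) → R r →
           ((j : Fin (arity r)) → Derives R (discharged r j ++ Δ) (premise r j)) →
           Derives R Δ (conclusion r)

-- Standing convention: atomic systems are consistent.
record AtomicSystem : Set₁ where
  field
    rules      : RuleSet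
    consistent : ¬ Derives rules [] bot
open AtomicSystem public

_⊢[_]_ : List At⊥ → AtomicSystem → At⊥ → Set
Δ ⊢[ S ] p = Derives (rules S) Δ p

_⊆S_ : AtomicSystem → AtomicSystem → Set
S ⊆S S' = ∀ r → rules S r → rules S' r

data Tag : Set where
  i c : Tag

data Form : Set where
  at   : Tag → At⊥ → Form
  _∧[_]_ : Form → Tag → Form → Form
  _∨[_]_ : Form → Tag → Form → Form
  _⇒[_]_ : Form → Tag → Form → Form

-- Weak validity  ⊩^L_S A  (clauses (1)-(6)); clauses (7)/(8) for singleton
-- contexts are unfolded inline.

mutual
  ⊩L : AtomicSystem → Form → Set₁
  ⊩L S (at i p) = Lift (lsuc 0ℓ) ([] ⊢[ S ] p)
  ⊩L S (at c p) = Lift (lsuc 0ℓ) (¬ ((p ∷ []) ⊢[ S ] bot))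
  ⊩L S (A ∧[ i ] B) = ∧i S A B
  ⊩L S (A ∨[ i ] B) = ∨i S A B
  ⊩L S (A ⇒[ i ] B) = ⇒i S A B
  -- (3): X^c iff  X^i ⊮^L_S ⊥, where X^i ⊩^L_S ⊥ unfolds by (7) and (1)
  ⊩L S (A ∧[ c ] B) =
    ¬ (∀ S' → S ⊆S S' → ∧i S' A B → Lift (lsuc 0ℓ) ([] ⊢[ S' ] bot))
  ⊩L S (A ∨[ c ] B) =
    ¬ (∀ S' → S ⊆S S' → ∨i S' A B → Lift (lsuc 0ℓ) ([] ⊢[ S' ] bot))
  ⊩L S (A ⇒[ c ] B) =
    ¬ (∀ S' → S ⊆S S' → ⇒i S' A B → Lift (lsuc 0ℓ) ([] ⊢[ S' ] bot))

  ∧i : AtomicSystem → Form → Form → Set₁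
  ∧i S A B = ⊩L S A × ⊩L S B

  -- (A ∨ B)^i : for all S' ⊇ S and p, if A ⊩^L_{S'} p^i and B ⊩^L_{S'} p^i
  -- then ⊩^L_{S'} p^i  (A ⊩^L_{S'} p^i unfolded by (7))
  ∨i : AtomicSystem → Form → Form → Set₁
  ∨i S A B = ∀ S' → S ⊆S S' → ∀ (p : At⊥) →
    (∀ S'' → S' ⊆S S'' → ⊩L S'' A → ⊩L S'' (at i p)) →
    (∀ S'' → S' ⊆S S'' → ⊩L S'' B → ⊩L S'' (at i p)) →
    ⊩L S' (at i p)

  -- (A → B)^i : A ⊩^G_S B  (unfolded by (8) with Γ = {A})
  ⇒i : AtomicSystem → Form → Form → Set₁
  ⇒i S A B = ∀ S' → S ⊆S S' →
    (∀ S'' → S' ⊆S S'' → ⊩L S'' A) →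
    (∀ S'' → S' ⊆S S'' → ⊩L S'' B)

NonEmpty : (Form → Set) → Set
NonEmpty Γ = Σ Form Γ

-- (7)  Γ ⊩^L_S A  (used for nonempty Γ)
_⊩L[_]_ : (Form → Set) → AtomicSystem → Form → Set₁
Γ ⊩L[ S ] A = ∀ S' → S ⊆S S' → (∀ B → Γ B → ⊩L S' B) → ⊩L S' A

-- (8)  Γ ⊩^G_S A
_⊩G[_]_ : (Form → Set) → AtomicSystem → Form → Set₁
Γ ⊩G[ S ] A = ∀ S' → S ⊆S S' →
  (∀ S'' → S' ⊆S S'' → ∀ B → Γ B → ⊩L S'' B) →
  (∀ S'' → S' ⊆S S'' → ⊩L S'' A)

module Submission where

open import Defs

⊆S-trans : ∀ {S S' S''} → S ⊆S S' → S' ⊆S S'' → S ⊆S S''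
⊆S-trans S⊆S' S'⊆S'' r r∈S = S'⊆S'' r (S⊆S' r r∈S)

lemma2 : (S : AtomicSystem) (Γ : Form → Set) (A : Form) →
    NonEmpty Γ → Γ ⊩L[ S ] A → Γ ⊩G[ S ] A
lemma2 S Γ A _ Γ⊩LA S' S⊆S' ⊩Γ S'' S'⊆S'' =
  Γ⊩LA S'' (⊆S-trans {S} {S'} {S''} S⊆S' S'⊆S'') (⊩Γ S'' S'⊆S'')
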